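{- Let $q$ be a power of an odd prime and $k\in\mathbb{F}_q$. Then $$\prod\mathcal{S}_k^{+}=\begin{cases}(-1)^{(q-1)/2}/(2k) & \text{if $k$ is a nonzero square in }\mathbb{F}_q,\\ (-1)^{(q+1)/2}\cdot 2 & \text{if $k$ is a nonsquare in }\mathbb{F}_q,\\ (-1)^{(q+1)/2} & \text{if } k=0,\end{cases}\qquad \prod\mathcal{S}_k^{ - }=\begin{cases}(-1)^{(q-1)/2}\cdot 2 & \text{if $k$ is a nonzero square},\\ (-1)^{(q+1)/2}/(2k) & \text{if $k$ is a nonsquare},\\ (-1)^{(q-1)/2} & \text{if } k=0.\end{cases}$$
   Context: $\mathbb{F}_q$ is the field with $q$ elements. For $a\in\mathbb{F}_q$, $\left(\frac{a}{q}\right)$ is the Legendre symbol ($1$ on nonzero squares, $-1$ on nonsquares, $0$ at $0$). $\mathcal{S}_k^{+}=\{a\in\mathbb{F}_q^\times:\left(\frac{a+k}{q}\right)=1\}$ and $\mathcal{S}_k^{ - }=\{a\in\mathbb{F}_q^\times:\left(\frac{a+k}{q}\right)=-1\}$. For a finite $S\subset\mathbb{F}_q^\times$, $\prod S$ denotes the product of its elements ($\prod\emptyset=1$). -}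

module Defs where

open import Data.Nat as ℕ using (ℕ; zero; suc)
open import Data.Integer as ℤ using (ℤ; 0ℤ; 1ℤ; -1ℤ)
open import Data.List using (List; filter; foldr; length)
open import Data.List.Membership.Propositional using (_∈_)
open import Data.List.Relation.Unary.Unique.Propositional using (Unique)
open import Data.List.Relation.Unary.Any using (any?)
open import Data.Product using (Σ; ∃; _×_; _,_)
open import Relation.Nullary using (¬_; Dec; yes; no)
open import Relation.Nullary.Decidable using (_×-dec_; ¬?)
open import Relation.Binary.PropositionalEquality using (_≡_; _≢_)
import Algebra.Structures as AS
open import Level using (0ℓ)

record FiniteField : Set₁ where
  infixl 6 _+_
  infixl 7 _*_
  field
    Carrier : Set
    _+_ _*_ : Carrier → Carrier → Carrier
    -_      : Carrier → Carrier
    0# 1#   : Carrier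
    isCommutativeRing : AS.IsCommutativeRing {A = Carrier} _≡_ _+_ _*_ -_ 0# 1#
    0≢1     : 0# ≢ 1#
    _⁻¹     : Carrier → Carrier
    ⁻¹-inverse : ∀ x → x ≢ 0# → x * (x ⁻¹) ≡ 1#
    _≟_     : (x y : Carrier) → Dec (x ≡ y)
    elements : List Carrier
    elements-unique : Unique elements
    elements-complete : ∀ x → x ∈ elements

module FieldDefs (F : FiniteField) where
  open FiniteField F public

  card : ℕ
  card = length elements

  two : Carrier
  two = 1# + 1#

  _^_ : Carrier → ℕ → Carrier
  x ^ zero = 1#
  x ^ suc n = x * (x ^ n)

  IsSquare : Carrier → Set
  IsSquare a = Σ Carrier λ b → b * b ≡ a

  isSquare? : (a : Carrier) → Dec (IsSquare a)
  isSquare? a with any? (λ b → (b * b) ≟ a) elements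
  ... | yes p = yes (help p)
    where
      open import Data.List.Relation.Unary.Any using (Any; here; there)
      help : ∀ {xs} → Any (λ b → b * b ≡ a) xs → IsSquare a
      help (here {x = b} e) = b , e
      help (there p) = help p
  ... | no ¬p = no λ { (b , e) → ¬p (lift (elements-complete b) e) }
    where
      open import Data.List.Relation.Unary.Any using (Any; here; there)
      open import Relation.Binary.PropositionalEquality using (subst; sym)
      lift : ∀ {xs b} → b ∈ xs → b * b ≡ a → Any (λ c → c * c ≡ a) xs
      lift {b = b} (here e) sq = here (subst (λ c → c * c ≡ a) e sq)
      lift (there m) sq = there (lift m sq)

  legendre : Carrier → ℤ
  legendre a with a ≟ 0#
  ... | yes _ = 0ℤ
  ... | no _ with isSquare? a
  ...   | yes _ = 1ℤ
  ...   | no _ = -1ℤ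

  prod : List Carrier → Carrier
  prod = foldr _*_ 1#

  S⁺ : Carrier → List Carrier
  S⁺ k = filter (λ a → ¬? (a ≟ 0#) ×-dec (legendre (a + k) ℤ.≟ 1ℤ)) elements

  S⁻ : Carrier → List Carrier
  S⁻ k = filter (λ a → ¬? (a ≟ 0#) ×-dec (legendre (a + k) ℤ.≟ -1ℤ)) elements

  sgn : ℕ → Carrier
  sgn n = (- 1#) ^ n

{-# OPTIONS --safe #-}
-- Write q = 2t + 1. By Fermat and a two-to-one count of squares, the t nonzero squares are
-- exactly the roots of x^t - 1 and the t nonsquares those of x^t + 1, so each is a set C of t
-- distinct roots of a binomial x^t + c. Translation by k identifies S_k^± with
-- {s - k : s ∈ C, s ≠ k}, whose product is (-1)^|C∖{k}| ∏ (k - s). If k ∉ C this is the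
-- binomial evaluated at k, namely c + k^t; if k ∈ C it is the derivative t k^(t-1) at k,
-- and since 2t = q - 1 = -1 in the field, 2k · t k^(t-1) = -k^t = c.
module Submission where

open import Defs
open import Data.Nat as ℕ using (ℕ; zero; suc; _∸_; _/_; _%_; _≤_; z≤n; s≤s)
import Data.Nat.Properties as ℕ
open import Data.Nat.DivMod using (m≡m%n+[m/n]*n; m%n<n; m*n/n≡m)
open import Data.Nat.Divisibility using (_∣_; m%n≡0⇒n∣m; ∣1⇒≡1)
open import Data.Nat.Primality using (Prime; euclidsLemma; prime[2])
open import Data.Integer as ℤ using (ℤ; 1ℤ; -1ℤ)
open import Data.List using (List; []; _∷_; filter; length; map; foldr; _++_)
open import Data.List.Properties using (length-++; filter-all; map-id)
open import Data.List.Membership.Propositional using (_∈_; _∉_)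
open import Data.List.Membership.Propositional.Properties
  using (∈-filter⁺; ∈-filter⁻; ∈-map⁺; ∈-map⁻; ∈-++⁻; ∈-++⁺ˡ; ∈-++⁺ʳ; ∈-∃++)
open import Data.List.Membership.Propositional.Properties.WithK using (unique∧set⇒bag)
open import Data.List.Relation.Binary.BagAndSetEquality using (∼bag⇒↭)
open import Data.List.Relation.Binary.Permutation.Propositional using (_↭_; ↭⇒↭ₛ)
open import Data.List.Relation.Binary.Permutation.Propositional.Properties using (↭-length)
import Data.List.Relation.Binary.Permutation.Setoid.Properties as PermutationSetoid
open import Data.List.Relation.Binary.Subset.Propositional using (_⊆_)
open import Data.List.Relation.Unary.All as All using (All; []; _∷_)
open import Data.List.Relation.Unary.AllPairs using ([]; _∷_)
open import Data.List.Relation.Unary.Any using (here; there)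
open import Data.List.Relation.Unary.Unique.Propositional using (Unique)
import Data.List.Relation.Unary.Unique.Propositional.Properties as Unique
open import Data.Vec using (Vec; []; _∷_; replicate)
open import Data.Product using (Σ; _×_; _,_; proj₁; proj₂)
open import Data.Sum using (_⊎_; inj₁; inj₂)
open import Data.Empty using (⊥-elim)
open import Function.Base using (id; case_of_)
open import Function.Bundles using (_⇔_; mk⇔; Equivalence)
open import Algebra.Bundles using (CommutativeRing)
open import Algebra.Structures using (module IsCommutativeRing)
import Algebra.Solver.CommutativeMonoid as CommutativeMonoidSolver
open import Relation.Nullary using (¬_; Dec; yes; no; ¬?)
open import Relation.Nullary.Decidable using (_×-dec_)
open import Relation.Unary using (Decidable)
open import Relation.Unary.Properties using (∁?)
open import Relation.Binary.PropositionalEquality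

module _ {A : Set} where

  unique-⊆⊇⇒↭ : {xs ys : List A} → Unique xs → Unique ys → xs ⊆ ys → ys ⊆ xs → xs ↭ ys
  unique-⊆⊇⇒↭ u v xs⊆ys ys⊆xs = ∼bag⇒↭ (unique∧set⇒bag u v (mk⇔ xs⊆ys ys⊆xs))

  ∈-map-≡ : {B : Set} (f : A → B) {x : A} {y : B} {xs : List A} → x ∈ xs → f x ≡ y → y ∈ map f xs
  ∈-map-≡ f x∈ refl = ∈-map⁺ f x∈

  length-filter+filter-∁ : {P : A → Set} (P? : Decidable P) (xs : List A) →
    length (filter P? xs) ℕ.+ length (filter (∁? P?) xs) ≡ length xs
  length-filter+filter-∁ P? [] = refl
  length-filter+filter-∁ P? (x ∷ xs) with P? x
  ... | yes _ = cong suc (length-filter+filter-∁ P? xs)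
  ... | no _  = trans (ℕ.+-suc _ _) (cong suc (length-filter+filter-∁ P? xs))

  unique-⊆⇒length-≤ : {xs ys : List A} → Unique xs → xs ⊆ ys → length xs ≤ length ys
  unique-⊆⇒length-≤ {[]} _ _ = z≤n
  unique-⊆⇒length-≤ {x ∷ xs} {ys} (x∉xs ∷ u) xs⊆ys with ∈-∃++ (xs⊆ys (here refl))
  ... | us , vs , refl = begin
      suc (length xs)            ≤⟨ s≤s (unique-⊆⇒length-≤ u xs⊆us++vs) ⟩
      suc (length (us ++ vs))    ≡⟨ cong suc (length-++ us) ⟩
      suc (length us ℕ.+ length vs) ≡⟨ ℕ.+-suc (length us) (length vs) ⟨
      length us ℕ.+ length (x ∷ vs) ≡⟨ length-++ us ⟨
      length (us ++ x ∷ vs)      ∎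
    where
    open ℕ.≤-Reasoning
    xs⊆us++vs : xs ⊆ us ++ vs
    xs⊆us++vs y∈xs with ∈-++⁻ us (xs⊆ys (there y∈xs))
    ... | inj₁ y∈us         = ∈-++⁺ˡ y∈us
    ... | inj₂ (here refl)  = ⊥-elim (All.lookup x∉xs y∈xs refl)
    ... | inj₂ (there y∈vs) = ∈-++⁺ʳ us y∈vs

  length≤2*length-fibres≤2 : {B : Set} (_≟_ : (x y : B) → Dec (x ≡ y)) (h : A → B) →
    (∀ y zs → Unique zs → All (λ z → h z ≡ y) zs → length zs ≤ 2) →
    ∀ xs ys → Unique xs → All (λ x → h x ∈ ys) xs → length xs ≤ 2 ℕ.* length ys
  length≤2*length-fibres≤2 _≟_ h fibre≤2 [] [] _ _ = z≤n
  length≤2*length-fibres≤2 _≟_ h fibre≤2 (x ∷ xs) [] _ (() All.∷ _)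
  length≤2*length-fibres≤2 _≟_ h fibre≤2 xs (y ∷ ys) u hxs∈ = begin
      length xs ≡⟨ length-filter+filter-∁ over-y? xs ⟨
      length (filter over-y? xs) ℕ.+ length (filter (∁? over-y?) xs)
        ≤⟨ ℕ.+-mono-≤ (fibre≤2 y _ (Unique.filter⁺ over-y? u) (All.tabulate (λ z∈ → proj₂ (∈-filter⁻ over-y? {xs = xs} z∈))))
                      (length≤2*length-fibres≤2 _≟_ h fibre≤2 _ ys (Unique.filter⁺ (∁? over-y?) u) (All.tabulate rest∈ys)) ⟩
      2 ℕ.+ 2 ℕ.* length ys ≡⟨ ℕ.*-suc 2 (length ys) ⟨
      2 ℕ.* suc (length ys) ∎
    where
    open ℕ.≤-Reasoning
    over-y? = λ x → h x ≟ y
    rest∈ys : ∀ {x} → x ∈ filter (∁? over-y?) xs → h x ∈ ys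
    rest∈ys x∈ with ∈-filter⁻ (∁? over-y?) x∈
    ... | x∈xs , hx≢y with All.lookup hxs∈ x∈xs
    ...   | here hx≡y  = ⊥-elim (hx≢y hx≡y)
    ...   | there hx∈ = hx∈

¬2∣⇒¬2∣^ : ∀ {p} → ¬ 2 ∣ p → ∀ n → ¬ 2 ∣ p ℕ.^ n
¬2∣⇒¬2∣^ 2∤p zero 2∣1 with () ← ∣1⇒≡1 2∣1
¬2∣⇒¬2∣^ {p} 2∤p (suc n) 2∣p^1+n with euclidsLemma p (p ℕ.^ n) prime[2] 2∣p^1+n
... | inj₁ 2∣p   = 2∤p 2∣p
... | inj₂ 2∣p^n = ¬2∣⇒¬2∣^ 2∤p n 2∣p^n

¬2∣⇒≡1+[n/2+n/2] : ∀ n → ¬ 2 ∣ n → n ≡ suc (n / 2 ℕ.+ n / 2)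
¬2∣⇒≡1+[n/2+n/2] n 2∤n with n % 2 in n%2≡ | m%n<n n 2
... | 0           | _ = ⊥-elim (2∤n (m%n≡0⇒n∣m n 2 n%2≡))
... | 1           | _ = trans (m≡m%n+[m/n]*n n 2)
                          (cong₂ ℕ._+_ n%2≡ (trans (ℕ.*-comm (n / 2) 2) (cong (n / 2 ℕ.+_) (ℕ.+-identityʳ (n / 2)))))
... | suc (suc _) | s≤s (s≤s ())

[m+m]/2≡m : ∀ m → (m ℕ.+ m) / 2 ≡ m
[m+m]/2≡m m = trans (cong (_/ 2) (trans (cong (m ℕ.+_) (sym (ℕ.+-identityʳ m))) (ℕ.*-comm 2 m))) (m*n/n≡m m 2)

odd-halves : ∀ {q} t → q ≡ suc (t ℕ.+ t) → (q ∸ 1) / 2 ≡ t × (q ℕ.+ 1) / 2 ≡ suc t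
odd-halves t refl = [m+m]/2≡m t , trans (cong (_/ 2) (trans (ℕ.+-comm _ 1) (cong suc (sym (ℕ.+-suc t t))))) ([m+m]/2≡m (suc t))

module FieldProperties (F : FiniteField) where
  open FieldDefs F
  open IsCommutativeRing isCommutativeRing public
    using (+-comm; *-comm; +-assoc; *-assoc; zeroˡ; zeroʳ; *-identityˡ; *-identityʳ;
           +-identityˡ; +-identityʳ; -‿inverseˡ; -‿inverseʳ; distribˡ; distribʳ;
           *-isCommutativeMonoid; +-isCommutativeMonoid)

  commutativeRing : CommutativeRing _ _
  commutativeRing = record { isCommutativeRing = isCommutativeRing }

  open import Algebra.Properties.Ring (CommutativeRing.ring commutativeRing) public
    using (-‿distribˡ-*; -‿distribʳ-*; x[y-z]≈xy-xz; -1*x≈-x; x∙y⁻¹≈ε⇒x≈y; +-inverseˡ-unique;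
           -‿involutive; -0#≈0#; -‿+-comm; +-identityʳ-unique; +-cancelʳ)
  open import Algebra.Properties.Monoid.Mult (CommutativeRing.+-monoid commutativeRing) public
    using () renaming (_×_ to _×ₙ_; ×-homo-+ to ×ₙ-homo-+)
  open CommutativeMonoidSolver (CommutativeRing.*-commutativeMonoid commutativeRing) public
    using () renaming (_⊕_ to _⊛_; _⊜_ to _⊜*_; solve to *-solve)
  open CommutativeMonoidSolver (CommutativeRing.+-commutativeMonoid commutativeRing) public
    using () renaming (_⊕_ to _⊞_; _⊜_ to _⊜+_; solve to +-solve)

  [x+y]-y≡x : ∀ x y → (x + y) + - y ≡ x
  [x+y]-y≡x x y = trans (+-assoc x y (- y)) (trans (cong (x +_) (-‿inverseʳ y)) (+-identityʳ x))

  [x-y]+y≡x : ∀ x y → (x + - y) + y ≡ x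
  [x-y]+y≡x x y = trans (+-assoc x (- y) y) (trans (cong (x +_) (-‿inverseˡ y)) (+-identityʳ x))

  x-y≡0⇒x≡y : ∀ {x y} → x + - y ≡ 0# → x ≡ y
  x-y≡0⇒x≡y {x} {y} = x∙y⁻¹≈ε⇒x≈y x y

  x+y≡0⇒x≡-y : ∀ {x y} → x + y ≡ 0# → x ≡ - y
  x+y≡0⇒x≡-y {x} {y} = +-inverseˡ-unique x y

  -1≢0 : - 1# ≢ 0#
  -1≢0 -1≡0 = 0≢1 (sym (trans (sym (-‿involutive 1#)) (trans (cong -_ -1≡0) -0#≈0#)))

  -1*-1≡1 : - 1# * - 1# ≡ 1#
  -1*-1≡1 = trans (-1*x≈-x (- 1#)) (-‿involutive 1#)

  x*y≡0⇒x≡0⊎y≡0 : ∀ {x y} → x * y ≡ 0# → x ≡ 0# ⊎ y ≡ 0#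
  x*y≡0⇒x≡0⊎y≡0 {x} {y} xy≡0 with x ≟ 0#
  ... | yes x≡0 = inj₁ x≡0
  ... | no x≢0 = inj₂ (begin
      y                ≡⟨ *-identityˡ y ⟨
      1# * y           ≡⟨ cong (_* y) (⁻¹-inverse x x≢0) ⟨
      (x * x ⁻¹) * y   ≡⟨ *-solve 3 (λ x i y → ((x ⊛ i) ⊛ y) ⊜* (i ⊛ (x ⊛ y))) refl x (x ⁻¹) y ⟩
      x ⁻¹ * (x * y)   ≡⟨ cong (x ⁻¹ *_) xy≡0 ⟩
      x ⁻¹ * 0#        ≡⟨ zeroʳ _ ⟩
      0#               ∎)
    where open ≡-Reasoning

  *-nonzero : ∀ {x y} → x ≢ 0# → y ≢ 0# → x * y ≢ 0#
  *-nonzero x≢0 y≢0 xy≡0 with x*y≡0⇒x≡0⊎y≡0 xy≡0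
  ... | inj₁ x≡0 = x≢0 x≡0
  ... | inj₂ y≡0 = y≢0 y≡0

  *-cancelˡ : ∀ {a x y} → a ≢ 0# → a * x ≡ a * y → x ≡ y
  *-cancelˡ {a} {x} {y} a≢0 ax≡ay
    with x*y≡0⇒x≡0⊎y≡0 (trans (x[y-z]≈xy-xz a x y) (trans (cong (_+ - (a * y)) ax≡ay) (-‿inverseʳ _)))
  ... | inj₁ a≡0   = ⊥-elim (a≢0 a≡0)
  ... | inj₂ x-y≡0 = x-y≡0⇒x≡y x-y≡0

  ⁻¹-nonzero : ∀ {a} → a ≢ 0# → a ⁻¹ ≢ 0#
  ⁻¹-nonzero {a} a≢0 a⁻¹≡0 = 0≢1 (trans (sym (zeroʳ a)) (trans (cong (a *_) (sym a⁻¹≡0)) (⁻¹-inverse a a≢0)))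

  *≡⇒≡*⁻¹ : ∀ {u x y} → u ≢ 0# → u * x ≡ y → x ≡ y * u ⁻¹
  *≡⇒≡*⁻¹ {u} {x} {y} u≢0 ux≡y = begin
      x                ≡⟨ *-identityʳ x ⟨
      x * 1#           ≡⟨ cong (x *_) (⁻¹-inverse u u≢0) ⟨
      x * (u * u ⁻¹)   ≡⟨ *-solve 3 (λ x u i → (x ⊛ (u ⊛ i)) ⊜* ((u ⊛ x) ⊛ i)) refl x u (u ⁻¹) ⟩
      (u * x) * u ⁻¹   ≡⟨ cong (_* u ⁻¹) ux≡y ⟩
      y * u ⁻¹         ∎
    where open ≡-Reasoning

  x*x≡z*z⇒x≡±z : ∀ {x z} → x * x ≡ z * z → x ≡ z ⊎ x ≡ - z
  x*x≡z*z⇒x≡±z {x} {z} x²≡z² with x*y≡0⇒x≡0⊎y≡0 {x + - z} {x + z} difference-of-squares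
    where
    open ≡-Reasoning
    difference-of-squares : (x + - z) * (x + z) ≡ 0#
    difference-of-squares = begin
      (x + - z) * (x + z)                        ≡⟨ distribʳ (x + z) x (- z) ⟩
      x * (x + z) + - z * (x + z)                ≡⟨ cong₂ _+_ (distribˡ x x z) (distribˡ (- z) x z) ⟩
      (x * x + x * z) + (- z * x + - z * z)      ≡⟨ cong₂ (λ a b → (x * x + x * z) + (a + b))
                                                      (trans (sym (-‿distribˡ-* z x)) (cong -_ (*-comm z x)))
                                                      (sym (-‿distribˡ-* z z)) ⟩
      (x * x + x * z) + (- (x * z) + - (z * z))  ≡⟨ +-solve 4 (λ a b nb c → ((a ⊞ b) ⊞ (nb ⊞ c)) ⊜+ ((a ⊞ c) ⊞ (b ⊞ nb)))
                                                      refl (x * x) (x * z) (- (x * z)) (- (z * z)) ⟩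
      (x * x + - (z * z)) + (x * z + - (x * z))  ≡⟨ cong₂ _+_ (trans (cong (_+ - (z * z)) x²≡z²) (-‿inverseʳ _)) (-‿inverseʳ _) ⟩
      0# + 0#                                    ≡⟨ +-identityʳ 0# ⟩
      0#                                         ∎
  ... | inj₁ x-z≡0 = inj₁ (x-y≡0⇒x≡y x-z≡0)
  ... | inj₂ x+z≡0 = inj₂ (x+y≡0⇒x≡-y x+z≡0)

  x-y≡-1*[y-x] : ∀ x y → x + - y ≡ - 1# * (y + - x)
  x-y≡-1*[y-x] x y = trans (+-inverseˡ-unique (x + - y) (y + - x) (begin
      (x + - y) + (y + - x)  ≡⟨ +-solve 4 (λ x ny y nx → ((x ⊞ ny) ⊞ (y ⊞ nx)) ⊜+ ((x ⊞ nx) ⊞ (y ⊞ ny))) refl x (- y) y (- x) ⟩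
      (x + - x) + (y + - y)  ≡⟨ cong₂ _+_ (-‿inverseʳ x) (-‿inverseʳ y) ⟩
      0# + 0#                ≡⟨ +-identityʳ 0# ⟩
      0#                     ∎)) (sym (-1*x≈-x _))
    where open ≡-Reasoning

  ^-+ : ∀ x m n → x ^ (m ℕ.+ n) ≡ x ^ m * x ^ n
  ^-+ x zero    n = sym (*-identityˡ _)
  ^-+ x (suc m) n = trans (cong (x *_) (^-+ x m n)) (sym (*-assoc x _ _))

  ^-distrib-* : ∀ x y n → (x * y) ^ n ≡ x ^ n * y ^ n
  ^-distrib-* x y zero    = sym (*-identityˡ _)
  ^-distrib-* x y (suc n) = trans (cong ((x * y) *_) (^-distrib-* x y n))
    (*-solve 4 (λ x y a b → ((x ⊛ y) ⊛ (a ⊛ b)) ⊜* ((x ⊛ a) ⊛ (y ⊛ b))) refl x y (x ^ n) (y ^ n))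

  sgn-+2 : ∀ n → sgn (suc (suc n)) ≡ sgn n
  sgn-+2 n = trans (sym (*-assoc (- 1#) (- 1#) _)) (trans (cong (_* sgn n) -1*-1≡1) (*-identityˡ _))

  prod-↭ : ∀ {xs ys} → xs ↭ ys → prod xs ≡ prod ys
  prod-↭ xs↭ys = PermutationSetoid.foldr-commMonoid (setoid Carrier) *-isCommutativeMonoid (↭⇒↭ₛ xs↭ys)

  prod-map-scaled : (f g : Carrier → Carrier) (a : Carrier) → (∀ x → f x ≡ a * g x) →
    ∀ xs → prod (map f xs) ≡ a ^ length xs * prod (map g xs)
  prod-map-scaled f g a f≡a*g [] = sym (*-identityˡ _)
  prod-map-scaled f g a f≡a*g (x ∷ xs) = trans (cong₂ _*_ (f≡a*g x) (prod-map-scaled f g a f≡a*g xs))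
    (*-solve 4 (λ a g n p → ((a ⊛ g) ⊛ (n ⊛ p)) ⊜* ((a ⊛ n) ⊛ (g ⊛ p))) refl a (g x) (a ^ length xs) (prod (map g xs)))

  prod-nonzero : ∀ {xs} → All (_≢ 0#) xs → prod xs ≢ 0#
  prod-nonzero []           1≡0 = 0≢1 (sym 1≡0)
  prod-nonzero (x≢0 ∷ xs≢0) = *-nonzero x≢0 (prod-nonzero xs≢0)

  sum : List Carrier → Carrier
  sum = foldr _+_ 0#

  sum-↭ : ∀ {xs ys} → xs ↭ ys → sum xs ≡ sum ys
  sum-↭ xs↭ys = PermutationSetoid.foldr-commMonoid (setoid Carrier) +-isCommutativeMonoid (↭⇒↭ₛ xs↭ys)

  sum-map-+1 : ∀ xs → sum (map (_+ 1#) xs) ≡ sum xs + length xs ×ₙ 1#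
  sum-map-+1 []       = sym (+-identityˡ _)
  sum-map-+1 (x ∷ xs) = trans (cong ((x + 1#) +_) (sum-map-+1 xs))
    (+-solve 4 (λ x o s n → ((x ⊞ o) ⊞ (s ⊞ n)) ⊜+ ((x ⊞ s) ⊞ (o ⊞ n))) refl x 1# (sum xs) (length xs ×ₙ 1#))

-- A monic polynomial of degree d is given by its d lower coefficients a₀ ∷ ⋯ ∷ a_{d-1}.
module MonicPolynomial (F : FiniteField) where
  open FieldDefs F
  open FieldProperties F

  Monic : ℕ → Set
  Monic = Vec Carrier

  eval : ∀ {d} → Monic d → Carrier → Carrier
  eval []      x = 1#
  eval (a ∷ p) x = a + x * eval p x

  Root : ∀ {d} → Monic d → Carrier → Set
  Root p r = eval p r ≡ 0#

  divide : ∀ {d} → Monic (suc d) → Carrier → Monic d × Carrier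
  divide (a ∷ [])    r = [] , a + r
  divide (a ∷ b ∷ p) r = (proj₂ (divide (b ∷ p) r) ∷ proj₁ (divide (b ∷ p) r)) , a + r * proj₂ (divide (b ∷ p) r)

  quotient : ∀ {d} → Monic (suc d) → Carrier → Monic d
  quotient p r = proj₁ (divide p r)

  remainder : ∀ {d} → Monic (suc d) → Carrier → Carrier
  remainder p r = proj₂ (divide p r)

  eval-divide : ∀ {d} (p : Monic (suc d)) r x → eval p x ≡ (x + - r) * eval (quotient p r) x + remainder p r
  eval-divide (a ∷ []) r x = begin
      a + x * 1#                   ≡⟨ cong (a +_) (*-identityʳ x) ⟩
      a + x                        ≡⟨ +-identityʳ _ ⟨
      (a + x) + 0#                 ≡⟨ cong ((a + x) +_) (-‿inverseˡ r) ⟨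
      (a + x) + (- r + r)          ≡⟨ +-solve 4 (λ a x nr r → ((a ⊞ x) ⊞ (nr ⊞ r)) ⊜+ ((x ⊞ nr) ⊞ (a ⊞ r))) refl a x (- r) r ⟩
      (x + - r) + (a + r)          ≡⟨ cong (_+ (a + r)) (*-identityʳ _) ⟨
      (x + - r) * 1# + (a + r)     ∎
    where open ≡-Reasoning
  eval-divide (a ∷ b ∷ p) r x = begin
      a + x * eval (b ∷ p) x                     ≡⟨ cong (λ e → a + x * e) (eval-divide (b ∷ p) r x) ⟩
      a + x * ((x + - r) * W + R)                ≡⟨ cong (a +_) (distribˡ x _ R) ⟩
      a + (x * ((x + - r) * W) + x * R)          ≡⟨ cong (λ e → a + (e + x * R)) (*-solve 3 (λ x y w → (x ⊛ (y ⊛ w)) ⊜* (y ⊛ (x ⊛ w))) refl x (x + - r) W) ⟩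
      a + (T + x * R)                            ≡⟨ +-identityʳ _ ⟨
      a + (T + x * R) + 0#                       ≡⟨ cong (a + (T + x * R) +_) (-‿inverseˡ (r * R)) ⟨
      a + (T + x * R) + (- (r * R) + r * R)      ≡⟨ +-solve 5 (λ a t xr nrr rr → ((a ⊞ (t ⊞ xr)) ⊞ (nrr ⊞ rr)) ⊜+ (((xr ⊞ nrr) ⊞ t) ⊞ (a ⊞ rr))) refl a T (x * R) (- (r * R)) (r * R) ⟩
      ((x * R + - (r * R)) + T) + (a + r * R)    ≡⟨ cong (λ e → ((x * R + e) + T) + (a + r * R)) (-‿distribˡ-* r R) ⟩
      ((x * R + - r * R) + T) + (a + r * R)      ≡⟨ cong (λ e → (e + T) + (a + r * R)) (distribʳ R x (- r)) ⟨
      ((x + - r) * R + T) + (a + r * R)          ≡⟨ cong (_+ (a + r * R)) (distribˡ (x + - r) R (x * W)) ⟨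
      (x + - r) * (R + x * W) + (a + r * R)      ∎
    where
    open ≡-Reasoning
    W = eval (quotient (b ∷ p) r) x
    R = remainder (b ∷ p) r
    T = (x + - r) * (x * W)

  remainder-root : ∀ {d} (p : Monic (suc d)) r → Root p r → remainder p r ≡ 0#
  remainder-root p r p[r]≡0 = sym (begin
      0#                                     ≡⟨ p[r]≡0 ⟨
      eval p r                               ≡⟨ eval-divide p r r ⟩
      (r + - r) * eval (quotient p r) r + R  ≡⟨ cong (λ e → e * eval (quotient p r) r + R) (-‿inverseʳ r) ⟩
      0# * eval (quotient p r) r + R         ≡⟨ cong (_+ R) (zeroˡ _) ⟩
      0# + R                                 ≡⟨ +-identityˡ R ⟩
      R                                      ∎)
    where
    open ≡-Reasoning
    R = remainder p r

  root-quotient : ∀ {d} (p : Monic (suc d)) {r s} → s ≢ r → Root p r → Root p s → Root (quotient p r) s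
  root-quotient p {r} {s} s≢r p[r]≡0 p[s]≡0 with x*y≡0⇒x≡0⊎y≡0 {s + - r} {eval (quotient p r) s} (begin
      (s + - r) * eval (quotient p r) s                   ≡⟨ +-identityʳ _ ⟨
      (s + - r) * eval (quotient p r) s + 0#              ≡⟨ cong ((s + - r) * eval (quotient p r) s +_) (remainder-root p r p[r]≡0) ⟨
      (s + - r) * eval (quotient p r) s + remainder p r   ≡⟨ eval-divide p r s ⟨
      eval p s                                            ≡⟨ p[s]≡0 ⟩
      0#                                                  ∎)
    where open ≡-Reasoning
  ... | inj₁ s-r≡0 = ⊥-elim (s≢r (x-y≡0⇒x≡y s-r≡0))
  ... | inj₂ q[s]≡0 = q[s]≡0

  roots-quotient : ∀ {d} (p : Monic (suc d)) {r rs} → All (r ≢_) rs → Root p r → All (Root p) rs →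
    All (Root (quotient p r)) rs
  roots-quotient p r≢rs p[r]≡0 p[rs]≡0 =
    All.zipWith (λ (r≢s , p[s]≡0) → root-quotient p (λ s≡r → r≢s (sym s≡r)) p[r]≡0 p[s]≡0) (r≢rs , p[rs]≡0)

  roots-length≤degree : ∀ {d} (p : Monic d) {rs} → Unique rs → All (Root p) rs → length rs ≤ d
  roots-length≤degree p       {[]}    _ _ = z≤n
  roots-length≤degree []      {_ ∷ _} _ (1≡0 ∷ _) = ⊥-elim (0≢1 (sym 1≡0))
  roots-length≤degree (a ∷ p) {r ∷ _} (r≢rs ∷ u) (p[r]≡0 ∷ p[rs]≡0) =
    s≤s (roots-length≤degree (quotient (a ∷ p) r) u (roots-quotient (a ∷ p) r≢rs p[r]≡0 p[rs]≡0))

  factorise : ∀ {d} (p : Monic d) {rs} → Unique rs → All (Root p) rs → length rs ≡ d →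
    ∀ x → eval p x ≡ prod (map (λ r → x + - r) rs)
  factorise []      {[]}    _ _ _ x = refl
  factorise (a ∷ p) {r ∷ rs} (r≢rs ∷ u) (p[r]≡0 ∷ p[rs]≡0) |rs|≡d x = begin
      eval (a ∷ p) x                                           ≡⟨ eval-divide (a ∷ p) r x ⟩
      (x + - r) * eval (quotient (a ∷ p) r) x + remainder (a ∷ p) r
        ≡⟨ cong₂ (λ q ρ → (x + - r) * q + ρ)
             (factorise (quotient (a ∷ p) r) u (roots-quotient (a ∷ p) r≢rs p[r]≡0 p[rs]≡0) (ℕ.suc-injective |rs|≡d) x)
             (remainder-root (a ∷ p) r p[r]≡0) ⟩
      (x + - r) * prod (map (λ r → x + - r) rs) + 0#           ≡⟨ +-identityʳ _ ⟩
      prod (map (λ r → x + - r) (r ∷ rs))                      ∎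
    where open ≡-Reasoning

  factorise-quotient : ∀ {d} (p : Monic (suc d)) {r rs} → Unique (r ∷ rs) → All (Root p) (r ∷ rs) → length rs ≡ d →
    ∀ x → eval (quotient p r) x ≡ prod (map (λ s → x + - s) rs)
  factorise-quotient p (r≢rs ∷ u) (p[r]≡0 ∷ p[rs]≡0) = factorise (quotient p _) u (roots-quotient p r≢rs p[r]≡0 p[rs]≡0)

  binomial : (j : ℕ) → Carrier → Monic (suc j)
  binomial j c = c ∷ replicate j 0#

  eval-replicate-0# : ∀ j x → eval (replicate j 0#) x ≡ x ^ j
  eval-replicate-0# zero    x = refl
  eval-replicate-0# (suc j) x = trans (+-identityˡ _) (cong (x *_) (eval-replicate-0# j x))

  eval-binomial : ∀ j c x → eval (binomial j c) x ≡ c + x ^ suc j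
  eval-binomial j c x = cong (λ e → c + x * e) (eval-replicate-0# j x)

  eval-quotient-binomial : ∀ j c r → eval (quotient (binomial j c) r) r ≡ suc j ×ₙ 1# * r ^ j
  eval-quotient-binomial zero    c r = sym (trans (*-identityʳ _) (+-identityʳ _))
  eval-quotient-binomial (suc j) c r = proj₁ (divide-power (suc j))
    where
    divide-power : ∀ j → eval (quotient (replicate (suc j) 0#) r) r ≡ suc j ×ₙ 1# * r ^ j
                       × remainder (replicate (suc j) 0#) r ≡ r ^ suc j
    divide-power zero = sym (trans (*-identityʳ _) (+-identityʳ _)) , trans (+-identityˡ r) (sym (*-identityʳ r))
    divide-power (suc j) = (begin
        R + r * eval Q r                ≡⟨ cong₂ (λ a b → a + r * b) (proj₂ (divide-power j)) (proj₁ (divide-power j)) ⟩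
        r * P + r * (N * P)             ≡⟨ cong (r * P +_) (*-solve 3 (λ r n p → (r ⊛ (n ⊛ p)) ⊜* (n ⊛ (r ⊛ p))) refl r N P) ⟩
        r * P + N * (r * P)             ≡⟨ cong (_+ N * (r * P)) (*-identityˡ _) ⟨
        1# * (r * P) + N * (r * P)      ≡⟨ distribʳ (r * P) 1# N ⟨
        (1# + N) * (r * P)              ∎)
      , trans (+-identityˡ _) (cong (r *_) (proj₂ (divide-power j)))
      where
      open ≡-Reasoning
      Q = quotient (replicate (suc j) 0#) r
      R = remainder (replicate (suc j) 0#) r
      N = suc j ×ₙ 1#
      P = r ^ j

module FiniteFieldProperties (F : FiniteField) where
  open FieldDefs F
  open FieldProperties F

  nonzero? : Decidable (_≢ 0#)
  nonzero? a = ¬? (a ≟ 0#)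

  nonzeros : List Carrier
  nonzeros = filter nonzero? elements

  nonzeros-unique : Unique nonzeros
  nonzeros-unique = Unique.filter⁺ nonzero? elements-unique

  ∈-nonzeros⁺ : ∀ {a} → a ≢ 0# → a ∈ nonzeros
  ∈-nonzeros⁺ = ∈-filter⁺ nonzero? (elements-complete _)

  ∈-nonzeros⁻ : ∀ {a} → a ∈ nonzeros → a ≢ 0#
  ∈-nonzeros⁻ a∈ = proj₂ (∈-filter⁻ nonzero? {xs = elements} a∈)

  card≡1+length-nonzeros : card ≡ suc (length nonzeros)
  card≡1+length-nonzeros = ↭-length (unique-⊆⊇⇒↭ elements-unique (All.tabulate (λ a∈ 0≡a → ∈-nonzeros⁻ a∈ (sym 0≡a)) ∷ nonzeros-unique)
    (λ {x} _ → zero-or-nonzero x) (λ _ → elements-complete _))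
    where
    zero-or-nonzero : ∀ x → x ∈ 0# ∷ nonzeros
    zero-or-nonzero x with x ≟ 0#
    ... | yes x≡0 = here x≡0
    ... | no x≢0  = there (∈-nonzeros⁺ x≢0)

  -- Translation by 1 permutes the field, so Σ x = Σ (x + 1) = Σ x + card.
  card×ₙ1≡0 : card ×ₙ 1# ≡ 0#
  card×ₙ1≡0 = +-identityʳ-unique (sum elements) (card ×ₙ 1#) (sym (begin
      sum elements                ≡⟨ sum-↭ +1-permutes ⟩
      sum (map (_+ 1#) elements)  ≡⟨ sum-map-+1 elements ⟩
      sum elements + card ×ₙ 1#   ∎))
    where
    open ≡-Reasoning
    +1-permutes : elements ↭ map (_+ 1#) elements
    +1-permutes = unique-⊆⊇⇒↭ elements-unique (Unique.map⁺ (+-cancelʳ 1# _ _) elements-unique)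
      (λ {x} _ → ∈-map-≡ (_+ 1#) (elements-complete (x + - 1#)) ([x-y]+y≡x x 1#))
      (λ _ → elements-complete _)

  -- Multiplication by a ≢ 0 permutes the nonzero elements, so a ^ (q - 1) ∏ x = ∏ (a x) = ∏ x.
  fermat : ∀ {a} → a ≢ 0# → a ^ length nonzeros ≡ 1#
  fermat {a} a≢0 = *-cancelˡ P≢0 (trans (*-comm P _) (trans a^n*P≡P (sym (*-identityʳ P))))
    where
    open ≡-Reasoning
    P = prod nonzeros
    P≢0 : P ≢ 0#
    P≢0 = prod-nonzero (All.tabulate ∈-nonzeros⁻)
    a*-permutes : map (a *_) nonzeros ↭ nonzeros
    a*-permutes = unique-⊆⊇⇒↭ (Unique.map⁺ (*-cancelˡ a≢0) nonzeros-unique) nonzeros-unique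
      (λ y∈ → case ∈-map⁻ (a *_) y∈ of λ { (x , x∈ , refl) → ∈-nonzeros⁺ (*-nonzero a≢0 (∈-nonzeros⁻ x∈)) })
      (λ {y} y∈ → ∈-map-≡ (a *_) (∈-nonzeros⁺ (*-nonzero (⁻¹-nonzero a≢0) (∈-nonzeros⁻ y∈)))
                    (trans (sym (*-assoc a (a ⁻¹) y)) (trans (cong (_* y) (⁻¹-inverse a a≢0)) (*-identityˡ y))))
    a^n*P≡P : a ^ length nonzeros * P ≡ P
    a^n*P≡P = begin
      a ^ length nonzeros * P                        ≡⟨ cong (a ^ length nonzeros *_) (cong prod (map-id nonzeros)) ⟨
      a ^ length nonzeros * prod (map id nonzeros)   ≡⟨ prod-map-scaled (a *_) id a (λ _ → refl) nonzeros ⟨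
      prod (map (a *_) nonzeros)                     ≡⟨ prod-↭ a*-permutes ⟩
      P                                              ∎

  nonsquare⇒nonzero : ∀ {a} → ¬ IsSquare a → a ≢ 0#
  nonsquare⇒nonzero ¬sq refl = ¬sq (0# , zeroˡ 0#)

  squares : List Carrier
  squares = filter isSquare? nonzeros

  nonsquares : List Carrier
  nonsquares = filter (∁? isSquare?) nonzeros

  squares-unique : Unique squares
  squares-unique = Unique.filter⁺ isSquare? nonzeros-unique

  nonsquares-unique : Unique nonsquares
  nonsquares-unique = Unique.filter⁺ (∁? isSquare?) nonzeros-unique

  ∈-squares⁺ : ∀ {a} → a ≢ 0# → IsSquare a → a ∈ squares
  ∈-squares⁺ a≢0 = ∈-filter⁺ isSquare? (∈-nonzeros⁺ a≢0)

  ∈-squares⁻ : ∀ {a} → a ∈ squares → a ≢ 0# × IsSquare a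
  ∈-squares⁻ a∈ with a∈nonzeros , sq ← ∈-filter⁻ isSquare? {xs = nonzeros} a∈ = ∈-nonzeros⁻ a∈nonzeros , sq

  ∈-nonsquares⁺ : ∀ {a} → ¬ IsSquare a → a ∈ nonsquares
  ∈-nonsquares⁺ ¬sq = ∈-filter⁺ (∁? isSquare?) (∈-nonzeros⁺ (nonsquare⇒nonzero ¬sq)) ¬sq

  ∈-nonsquares⁻ : ∀ {a} → a ∈ nonsquares → ¬ IsSquare a
  ∈-nonsquares⁻ a∈ = proj₂ (∈-filter⁻ (∁? isSquare?) {xs = nonzeros} a∈)

  length-squares+nonsquares : length squares ℕ.+ length nonsquares ≡ length nonzeros
  length-squares+nonsquares = length-filter+filter-∁ isSquare? nonzeros

  legendre≡1⇔∈squares : ∀ a → legendre a ≡ 1ℤ ⇔ a ∈ squares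
  legendre≡1⇔∈squares a with a ≟ 0#
  ... | yes a≡0 = mk⇔ (λ ()) (λ a∈ → ⊥-elim (proj₁ (∈-squares⁻ a∈) a≡0))
  ... | no a≢0 with isSquare? a
  ...   | yes sq = mk⇔ (λ _ → ∈-squares⁺ a≢0 sq) (λ _ → refl)
  ...   | no ¬sq = mk⇔ (λ ()) (λ a∈ → ⊥-elim (¬sq (proj₂ (∈-squares⁻ a∈))))

  legendre≡-1⇔∈nonsquares : ∀ a → legendre a ≡ -1ℤ ⇔ a ∈ nonsquares
  legendre≡-1⇔∈nonsquares a with a ≟ 0#
  ... | yes a≡0 = mk⇔ (λ ()) (λ a∈ → ⊥-elim (nonsquare⇒nonzero (∈-nonsquares⁻ a∈) a≡0))
  ... | no a≢0 with isSquare? a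
  ...   | yes sq = mk⇔ (λ ()) (λ a∈ → ⊥-elim (∈-nonsquares⁻ a∈ sq))
  ...   | no ¬sq = mk⇔ (λ _ → ∈-nonsquares⁺ ¬sq) (λ _ → refl)

  _without_ : List Carrier → Carrier → List Carrier
  xs without k = filter (λ s → ¬? (s ≟ k)) xs

  shift-↭ : ∀ {C} (z : ℤ) → Unique C → (∀ a → legendre a ≡ z ⇔ a ∈ C) → ∀ k →
    filter (λ a → ¬? (a ≟ 0#) ×-dec (legendre (a + k) ℤ.≟ z)) elements ↭ map (_+ - k) (C without k)
  shift-↭ {C} z C-unique legendre≡z⇔∈C k = unique-⊆⊇⇒↭ (Unique.filter⁺ S? elements-unique)
    (Unique.map⁺ (+-cancelʳ (- k) _ _) (Unique.filter⁺ ≢k? C-unique)) to from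
    where
    S? = λ a → ¬? (a ≟ 0#) ×-dec (legendre (a + k) ℤ.≟ z)
    ≢k? = λ s → ¬? (s ≟ k)
    to : ∀ {a} → a ∈ filter S? elements → a ∈ map (_+ - k) (C without k)
    to {a} a∈ with _ , (a≢0 , legendre≡z) ← ∈-filter⁻ S? {xs = elements} a∈ =
      ∈-map-≡ (_+ - k) (∈-filter⁺ ≢k? (Equivalence.to (legendre≡z⇔∈C _) legendre≡z) a+k≢k) ([x+y]-y≡x a k)
      where
      a+k≢k : a + k ≢ k
      a+k≢k a+k≡k = a≢0 (trans (sym ([x+y]-y≡x a k)) (trans (cong (_+ - k) a+k≡k) (-‿inverseʳ k)))
    from : ∀ {a} → a ∈ map (_+ - k) (C without k) → a ∈ filter S? elements
    from a∈ with s , s∈ , refl ← ∈-map⁻ (_+ - k) a∈ with s∈C , s≢k ← ∈-filter⁻ ≢k? {xs = C} s∈ =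
      ∈-filter⁺ S? (elements-complete _)
        ( (λ s-k≡0 → s≢k (x-y≡0⇒x≡y s-k≡0))
        , subst (λ w → legendre w ≡ z) (sym ([x-y]+y≡x s k)) (Equivalence.from (legendre≡z⇔∈C s) s∈C))

  2≤card : 2 ≤ card
  2≤card = unique-⊆⇒length-≤ {xs = 0# ∷ 1# ∷ []} ((0≢1 ∷ []) ∷ [] ∷ []) (λ _ → elements-complete _)

  odd-card : ¬ 2 ∣ card → Σ ℕ λ j → card ≡ suc (suc j ℕ.+ suc j)
  odd-card 2∤card with card / 2 | ¬2∣⇒≡1+[n/2+n/2] card 2∤card
  ... | suc j | card≡ = j , card≡
  ... | zero  | card≡ = ⊥-elim (ℕ.<-irrefl refl (ℕ.≤-trans 2≤card (ℕ.≤-reflexive card≡)))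

module OddOrder (F : FiniteField) (j : ℕ) (card≡ : FieldDefs.card F ≡ suc (suc j ℕ.+ suc j)) where
  open FieldDefs F
  open FieldProperties F
  open MonicPolynomial F
  open FiniteFieldProperties F

  t : ℕ
  t = suc j

  length-nonzeros≡t+t : length nonzeros ≡ t ℕ.+ t
  length-nonzeros≡t+t = ℕ.suc-injective (trans (sym card≡1+length-nonzeros) card≡)

  two*t≡-1 : two * t ×ₙ 1# ≡ - 1#
  two*t≡-1 = begin
      two * t ×ₙ 1#                      ≡⟨ distribʳ (t ×ₙ 1#) 1# 1# ⟩
      1# * t ×ₙ 1# + 1# * t ×ₙ 1#        ≡⟨ cong₂ _+_ (*-identityˡ _) (*-identityˡ _) ⟩
      t ×ₙ 1# + t ×ₙ 1#                  ≡⟨ x+y≡0⇒x≡-y (trans (+-comm _ 1#) (trans (cong (1# +_) (sym (×ₙ-homo-+ 1# t t))) 1+[t+t]≡0)) ⟩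
      - 1#                               ∎
    where
    open ≡-Reasoning
    1+[t+t]≡0 : suc (t ℕ.+ t) ×ₙ 1# ≡ 0#
    1+[t+t]≡0 = subst (λ n → n ×ₙ 1# ≡ 0#) card≡ card×ₙ1≡0

  two≢0 : two ≢ 0#
  two≢0 two≡0 = -1≢0 (trans (sym two*t≡-1) (trans (cong (_* (t ×ₙ 1#)) two≡0) (zeroˡ _)))

  ^t*^t≡1 : ∀ {a} → a ≢ 0# → a ^ t * a ^ t ≡ 1#
  ^t*^t≡1 {a} a≢0 = trans (sym (^-+ a t t)) (subst (λ n → a ^ n ≡ 1#) length-nonzeros≡t+t (fermat a≢0))

  square^t≡1 : ∀ {a} → a ∈ squares → a ^ t ≡ 1#
  square^t≡1 a∈ with b*b≢0 , b , refl ← ∈-squares⁻ a∈ =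
    trans (^-distrib-* b b t) (^t*^t≡1 (λ b≡0 → b*b≢0 (trans (cong (_* b) b≡0) (zeroˡ b))))

  squares-roots : All (Root (binomial j (- 1#))) squares
  squares-roots = All.tabulate (λ {s} s∈ → trans (eval-binomial j (- 1#) s)
                    (trans (cong (- 1# +_) (square^t≡1 s∈)) (-‿inverseˡ 1#)))

  square-fibre≤2 : ∀ y zs → Unique zs → All (λ z → z * z ≡ y) zs → length zs ≤ 2
  square-fibre≤2 y []       _ _ = z≤n
  square-fibre≤2 y (z ∷ zs) u z²≡y = unique-⊆⇒length-≤ {ys = z ∷ - z ∷ []} u ±z
    where
    ±z : ∀ {x} → x ∈ z ∷ zs → x ∈ z ∷ - z ∷ []
    ±z x∈ with x*x≡z*z⇒x≡±z (trans (All.lookup z²≡y x∈) (sym (All.head z²≡y)))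
    ... | inj₁ x≡z  = here x≡z
    ... | inj₂ x≡-z = there (here x≡-z)

  -- Squaring maps the t + t nonzero elements at most two-to-one onto the squares.
  length-squares≡t : length squares ≡ t
  length-squares≡t = ℕ.≤-antisym (roots-length≤degree (binomial j (- 1#)) squares-unique squares-roots) t≤length
    where
    t≤length : t ≤ length squares
    t≤length = ℕ.*-cancelˡ-≤ 2 (subst (_≤ 2 ℕ.* length squares) (trans length-nonzeros≡t+t (cong (t ℕ.+_) (sym (ℕ.+-identityʳ t))))
      (length≤2*length-fibres≤2 _≟_ (λ x → x * x) square-fibre≤2 nonzeros squares nonzeros-unique
        (All.tabulate (λ {x} x∈ → ∈-squares⁺ (*-nonzero (∈-nonzeros⁻ x∈) (∈-nonzeros⁻ x∈)) (x , refl)))))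

  length-nonsquares≡t : length nonsquares ≡ t
  length-nonsquares≡t = ℕ.+-cancelˡ-≡ t _ _
    (trans (cong (ℕ._+ length nonsquares) (sym length-squares≡t)) (trans length-squares+nonsquares length-nonzeros≡t+t))

  -- a ^ t is a square root of 1, and a ^ t = 1 would give x ^ t - 1 a (t + 1)-th root.
  nonsquare^t≡-1 : ∀ {a} → a ∈ nonsquares → a ^ t ≡ - 1#
  nonsquare^t≡-1 {a} a∈
    with x*x≡z*z⇒x≡±z (trans (^t*^t≡1 (nonsquare⇒nonzero (∈-nonsquares⁻ a∈))) (sym (*-identityˡ 1#)))
  ... | inj₂ a^t≡-1 = a^t≡-1
  ... | inj₁ a^t≡1 = ⊥-elim (ℕ.<-irrefl refl (subst (_≤ t) (cong suc length-squares≡t)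
          (roots-length≤degree (binomial j (- 1#)) a∷squares-unique (a-root ∷ squares-roots))))
    where
    a∷squares-unique : Unique (a ∷ squares)
    a∷squares-unique = All.tabulate (λ s∈ a≡s → ∈-nonsquares⁻ a∈ (subst IsSquare (sym a≡s) (proj₂ (∈-squares⁻ s∈)))) ∷ squares-unique
    a-root : Root (binomial j (- 1#)) a
    a-root = trans (eval-binomial j (- 1#) a) (trans (cong (- 1# +_) a^t≡1) (-‿inverseˡ 1#))

  nonsquares-roots : All (Root (binomial j 1#)) nonsquares
  nonsquares-roots = All.tabulate (λ {s} s∈ → trans (eval-binomial j 1# s)
                       (trans (cong (1# +_) (nonsquare^t≡-1 s∈)) (-‿inverseʳ 1#)))

  module ShiftedProduct {C : List Carrier} {c : Carrier} (C-unique : Unique C) (length-C≡t : length C ≡ t)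
           (C-roots : All (Root (binomial j c)) C) (k : Carrier) where

    private
      K = C without k
      ≢k? = λ s → ¬? (s ≟ k)

    prod-shifted≡sgn*prod : ∀ n → length K ≡ n → prod (map (_+ - k) K) ≡ sgn n * prod (map (λ s → k + - s) K)
    prod-shifted≡sgn*prod n refl = prod-map-scaled (_+ - k) (λ s → k + - s) (- 1#) (λ s → x-y≡-1*[y-x] s k) K

    prod-shifted-∈ : k ≢ 0# → k ∈ C → prod (map (_+ - k) K) ≡ (sgn j * c) * (two * k) ⁻¹
    prod-shifted-∈ k≢0 k∈C = *≡⇒≡*⁻¹ (*-nonzero two≢0 k≢0) (begin
        (two * k) * prod (map (_+ - k) K)                    ≡⟨ cong ((two * k) *_) (prod-shifted≡sgn*prod j length-K≡j) ⟩
        (two * k) * (sgn j * prod (map (λ s → k + - s) K))   ≡⟨ cong (λ e → (two * k) * (sgn j * e)) ∏[k-K]≡t*k^j ⟩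
        (two * k) * (sgn j * (t ×ₙ 1# * k ^ j))              ≡⟨ *-solve 5 (λ w k s n p → ((w ⊛ k) ⊛ (s ⊛ (n ⊛ p))) ⊜* (s ⊛ ((w ⊛ n) ⊛ (k ⊛ p))))
                                                                  refl two k (sgn j) (t ×ₙ 1#) (k ^ j) ⟩
        sgn j * ((two * t ×ₙ 1#) * k ^ t)                    ≡⟨ cong₂ (λ a b → sgn j * (a * b)) two*t≡-1 k^t≡-c ⟩
        sgn j * (- 1# * - c)                                 ≡⟨ cong (sgn j *_) (trans (-1*x≈-x (- c)) (-‿involutive c)) ⟩
        sgn j * c                                            ∎)
      where
      open ≡-Reasoning
      K⊆C : ∀ {s} → s ∈ K → s ∈ C
      K⊆C s∈ = proj₁ (∈-filter⁻ ≢k? {xs = C} s∈)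
      k∷K-unique : Unique (k ∷ K)
      k∷K-unique = All.tabulate (λ s∈ k≡s → proj₂ (∈-filter⁻ ≢k? {xs = C} s∈) (sym k≡s)) ∷ Unique.filter⁺ ≢k? C-unique
      C↭k∷K : C ↭ k ∷ K
      C↭k∷K = unique-⊆⊇⇒↭ C-unique k∷K-unique (λ {s} → k-or-K s) λ { (here refl) → k∈C ; (there s∈) → K⊆C s∈ }
        where
        k-or-K : ∀ s → s ∈ C → s ∈ k ∷ K
        k-or-K s s∈ with s ≟ k
        ... | yes s≡k = here s≡k
        ... | no s≢k  = there (∈-filter⁺ ≢k? s∈ s≢k)
      length-K≡j : length K ≡ j
      length-K≡j = ℕ.suc-injective (trans (sym (↭-length C↭k∷K)) length-C≡t)
      k^t≡-c : k ^ t ≡ - c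
      k^t≡-c = x+y≡0⇒x≡-y (trans (+-comm _ c) (trans (sym (eval-binomial j c k)) (All.lookup C-roots k∈C)))
      ∏[k-K]≡t*k^j : prod (map (λ s → k + - s) K) ≡ t ×ₙ 1# * k ^ j
      ∏[k-K]≡t*k^j = trans (sym (factorise-quotient (binomial j c) k∷K-unique
                                  (All.lookup C-roots k∈C ∷ All.tabulate (λ s∈ → All.lookup C-roots (K⊆C s∈))) length-K≡j k))
                           (eval-quotient-binomial j c k)

    prod-shifted-∉ : k ∉ C → prod (map (_+ - k) K) ≡ sgn t * (c + k ^ t)
    prod-shifted-∉ k∉C = begin
        prod (map (_+ - k) K)                  ≡⟨ prod-shifted≡sgn*prod t (trans (cong length K≡C) length-C≡t) ⟩
        sgn t * prod (map (λ s → k + - s) K)   ≡⟨ cong (λ l → sgn t * prod (map (λ s → k + - s) l)) K≡C ⟩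
        sgn t * prod (map (λ s → k + - s) C)   ≡⟨ cong (sgn t *_) (factorise (binomial j c) C-unique C-roots length-C≡t k) ⟨
        sgn t * eval (binomial j c) k          ≡⟨ cong (sgn t *_) (eval-binomial j c k) ⟩
        sgn t * (c + k ^ t)                    ∎
      where
      open ≡-Reasoning
      K≡C : K ≡ C
      K≡C = filter-all ≢k? (All.tabulate (λ s∈ s≡k → k∉C (subst (_∈ C) s≡k s∈)))

  prod-S⁺≡ : ∀ k → prod (S⁺ k) ≡ prod (map (_+ - k) (squares without k))
  prod-S⁺≡ k = prod-↭ (shift-↭ 1ℤ squares-unique legendre≡1⇔∈squares k)

  prod-S⁻≡ : ∀ k → prod (S⁻ k) ≡ prod (map (_+ - k) (nonsquares without k))
  prod-S⁻≡ k = prod-↭ (shift-↭ -1ℤ nonsquares-unique legendre≡-1⇔∈nonsquares k)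

  private
    module Squares    = ShiftedProduct squares-unique length-squares≡t squares-roots
    module Nonsquares = ShiftedProduct nonsquares-unique length-nonsquares≡t nonsquares-roots

  prod-S±-square : ∀ {k} → k ∈ squares →
    prod (S⁺ k) ≡ sgn t * (two * k) ⁻¹ × prod (S⁻ k) ≡ sgn t * two
  prod-S±-square {k} k∈ =
      (begin
        prod (S⁺ k)                                 ≡⟨ prod-S⁺≡ k ⟩
        prod (map (_+ - k) (squares without k))     ≡⟨ Squares.prod-shifted-∈ k (proj₁ (∈-squares⁻ k∈)) k∈ ⟩
        (sgn j * - 1#) * (two * k) ⁻¹               ≡⟨ cong (_* (two * k) ⁻¹) (*-comm (sgn j) (- 1#)) ⟩
        sgn t * (two * k) ⁻¹                        ∎)
    , (begin
        prod (S⁻ k)                                 ≡⟨ prod-S⁻≡ k ⟩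
        prod (map (_+ - k) (nonsquares without k))  ≡⟨ Nonsquares.prod-shifted-∉ k (λ k∈N → ∈-nonsquares⁻ k∈N (proj₂ (∈-squares⁻ k∈))) ⟩
        sgn t * (1# + k ^ t)                        ≡⟨ cong (λ e → sgn t * (1# + e)) (square^t≡1 k∈) ⟩
        sgn t * two                                 ∎)
    where open ≡-Reasoning

  prod-S±-nonsquare : ∀ {k} → k ∈ nonsquares →
    prod (S⁺ k) ≡ sgn (suc t) * two × prod (S⁻ k) ≡ sgn (suc t) * (two * k) ⁻¹
  prod-S±-nonsquare {k} k∈ =
      (begin
        prod (S⁺ k)                                 ≡⟨ prod-S⁺≡ k ⟩
        prod (map (_+ - k) (squares without k))     ≡⟨ Squares.prod-shifted-∉ k (λ k∈Q → ∈-nonsquares⁻ k∈ (proj₂ (∈-squares⁻ k∈Q))) ⟩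
        sgn t * (- 1# + k ^ t)                      ≡⟨ cong (λ e → sgn t * (- 1# + e)) (nonsquare^t≡-1 k∈) ⟩
        sgn t * (- 1# + - 1#)                       ≡⟨ cong (sgn t *_) (-‿+-comm 1# 1#) ⟩
        sgn t * - two                               ≡⟨ -‿distribʳ-* (sgn t) two ⟨
        - (sgn t * two)                             ≡⟨ -1*x≈-x _ ⟨
        - 1# * (sgn t * two)                        ≡⟨ *-assoc (- 1#) (sgn t) two ⟨
        sgn (suc t) * two                           ∎)
    , (begin
        prod (S⁻ k)                                 ≡⟨ prod-S⁻≡ k ⟩
        prod (map (_+ - k) (nonsquares without k))  ≡⟨ Nonsquares.prod-shifted-∈ k (nonsquare⇒nonzero (∈-nonsquares⁻ k∈)) k∈ ⟩
        (sgn j * 1#) * (two * k) ⁻¹                 ≡⟨ cong (_* (two * k) ⁻¹) (trans (*-identityʳ (sgn j)) (sym (sgn-+2 j))) ⟩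
        sgn (suc t) * (two * k) ⁻¹                  ∎)
    where open ≡-Reasoning

  prod-S±-zero : prod (S⁺ 0#) ≡ sgn (suc t) × prod (S⁻ 0#) ≡ sgn t
  prod-S±-zero =
      (begin
        prod (S⁺ 0#)                                ≡⟨ prod-S⁺≡ 0# ⟩
        prod (map (_+ - 0#) (squares without 0#))   ≡⟨ Squares.prod-shifted-∉ 0# (λ 0∈ → proj₁ (∈-squares⁻ 0∈) refl) ⟩
        sgn t * (- 1# + 0# ^ t)                     ≡⟨ cong (λ e → sgn t * (- 1# + e)) (zeroˡ _) ⟩
        sgn t * (- 1# + 0#)                         ≡⟨ cong (sgn t *_) (+-identityʳ _) ⟩
        sgn t * - 1#                                ≡⟨ *-comm (sgn t) (- 1#) ⟩
        sgn (suc t)                                 ∎)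
    , (begin
        prod (S⁻ 0#)                                ≡⟨ prod-S⁻≡ 0# ⟩
        prod (map (_+ - 0#) (nonsquares without 0#)) ≡⟨ Nonsquares.prod-shifted-∉ 0# (λ 0∈ → nonsquare⇒nonzero (∈-nonsquares⁻ 0∈) refl) ⟩
        sgn t * (1# + 0# ^ t)                       ≡⟨ cong (λ e → sgn t * (1# + e)) (zeroˡ _) ⟩
        sgn t * (1# + 0#)                           ≡⟨ cong (sgn t *_) (+-identityʳ _) ⟩
        sgn t * 1#                                  ≡⟨ *-identityʳ _ ⟩
        sgn t                                       ∎)
    where open ≡-Reasoning

theorem2p4 : (F : FiniteField) → let open FieldDefs F in
    (Σ ℕ λ p → Σ ℕ λ n → Prime p × ¬ (2 ∣ p) × card ≡ p ℕ.^ suc n) →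
    (k : Carrier) →
      ((k ≢ 0# → legendre k ≡ 1ℤ →
          prod (S⁺ k) ≡ sgn ((card ∸ 1) / 2) * ((two * k) ⁻¹)
        × prod (S⁻ k) ≡ sgn ((card ∸ 1) / 2) * two)
      × (legendre k ≡ -1ℤ →
          prod (S⁺ k) ≡ sgn ((card ℕ.+ 1) / 2) * two
        × prod (S⁻ k) ≡ sgn ((card ℕ.+ 1) / 2) * ((two * k) ⁻¹))
      × (k ≡ 0# →
          prod (S⁺ k) ≡ sgn ((card ℕ.+ 1) / 2)
        × prod (S⁻ k) ≡ sgn ((card ∸ 1) / 2)))
theorem2p4 F (p , n , _ , 2∤p , card≡p^n) k
  with j , card≡ ← FiniteFieldProperties.odd-card F (subst (λ q → ¬ 2 ∣ q) (sym card≡p^n) (¬2∣⇒¬2∣^ 2∤p (suc n)))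
  with odd-halves (suc j) card≡
... | [q-1]/2≡t , [q+1]/2≡t+1 rewrite [q-1]/2≡t | [q+1]/2≡t+1 =
      (λ _ legendre≡1 → prod-S±-square (Equivalence.to (legendre≡1⇔∈squares k) legendre≡1))
    , (λ legendre≡-1 → prod-S±-nonsquare (Equivalence.to (legendre≡-1⇔∈nonsquares k) legendre≡-1))
    , (λ { refl → prod-S±-zero })
  where
  open FieldDefs F
  open FiniteFieldProperties F
  open OddOrder F j card≡
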